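{- Let $(E,w,d)$ be a full ultra triple, let $C\subseteq E$ be any subset, and let $m$ be a nonnegative integer. Let $(c_1,c_2,\ldots,c_m)$ be any greedy $m$-subsequence of $C$. Then, for each $k\in\{0,1,\ldots,m\}$, the $k$-tuple $(c_1,\ldots,c_k)$ has maximum perimeter among all $k$-subsequences of $C$.
   Context: A full ultra triple $(E,w,d)$ consists of a set $E$, a function $w:E\to\mathbb{R}$, and a function $d:E\times E\to\mathbb{R}$ such that $d(a,b)=d(b,a)$ for all $a,b\in E$ and $d(a,b)\le\max\{d(a,c),d(b,c)\}$ for all $a,b,c\in E$ (not necessarily distinct; $d(a,a)$ may be nonzero or negative). For $B\subseteq E$, an $m$-subsequence of $B$ is an $m$-tuple of (not necessarily distinct) elements of $B$. The perimeter of an $m$-tuple $\mathbf{a}=(a_1,\ldots,a_m)\in E^m$ is $\operatorname{PER}(\mathbf{a})=\sum_{k=1}^m w(a_k)+\sum_{1\le i<j\le m}d(a_i,a_j)$. A greedy $m$-subsequence of $C$ is an $m$-subsequence $(c_1,\ldots,c_m)$ of $C$ such that for each $i\in\{1,\ldots,m\}$ and each $x\in C$, $\operatorname{PER}(c_1,\ldots,c_i)\ge\operatorname{PER}(c_1,\ldots,c_{i-1},x)$. -}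

module Defs where

open import Level using (Level; suc; _⊔_)
open import Data.Nat using (ℕ)
open import Data.List using (List; []; _∷_)
open import Data.Sum using (_⊎_)
open import Relation.Binary.PropositionalEquality using (_≡_)
open import Algebra.Structures using (IsAbelianGroup)
open import Relation.Binary.Structures using (IsTotalOrder)

-- The real numbers are not available in agda-stdlib.  We work over an
-- arbitrary linearly ordered abelian group (ℝ with + and ≤ is an instance).
record OrderedAbelianGroup (c ℓ : Level) : Set (Level.suc (c ⊔ ℓ)) where
  infixl 6 _+_
  infix 4 _≤_
  field
    Carrier        : Set c
    _+_            : Carrier → Carrier → Carrier
    0#             : Carrier
    -_             : Carrier → Carrier
    _≤_            : Carrier → Carrier → Set ℓ
    isAbelianGroup : IsAbelianGroup _≡_ _+_ 0# -_
    isTotalOrder   : IsTotalOrder _≡_ _≤_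
    +-mono-≤       : ∀ {x y} z → x ≤ y → x + z ≤ y + z

-- A full ultra triple (E, w, d) with values in the ordered group R.
-- d(a,b) ≤ max{d(a,c), d(b,c)} is written as the disjunction it unfolds to
-- in a total order.
record FullUltraTriple {c ℓ : Level} (R : OrderedAbelianGroup c ℓ) (E : Set) : Set (c ⊔ ℓ) where
  open OrderedAbelianGroup R
  field
    w     : E → Carrier
    d     : E → E → Carrier
    d-sym : ∀ a b → d a b ≡ d b a
    d-ult : ∀ a b c → (d a b ≤ d a c) ⊎ (d a b ≤ d b c)

module Perimeter {c ℓ : Level} {R : OrderedAbelianGroup c ℓ} {E : Set}
                 (T : FullUltraTriple R E) where
  open OrderedAbelianGroup R
  open FullUltraTriple T

  sumW : List E → Carrier
  sumW []       = 0#
  sumW (x ∷ xs) = w x + sumW xs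

  sumD : E → List E → Carrier
  sumD x []       = 0#
  sumD x (y ∷ ys) = d x y + sumD x ys

  sumPairs : List E → Carrier
  sumPairs []       = 0#
  sumPairs (x ∷ xs) = sumD x xs + sumPairs xs

  PER : List E → Carrier
  PER as = sumW as + sumPairs as

module Submission where

-- Write gain(y, bs) = w(y) + Σ_{z ∈ bs} d(y, z) for the amount by which the
-- perimeter grows when y is inserted (anywhere) into bs, so that
-- PER(b) = PER(b′) + gain(y, b′) whenever b arises from b′ by inserting y.
--
-- The heart of the proof is an exchange lemma for ultrametric-like d: if
-- |bs| = |cs| + 1 then some element y of bs, with bs′ the rest of bs, has
-- Σ_{z ∈ bs′} d(y, z) ≤ Σ_{c ∈ cs} d(y, c).  It is proved by induction on cs:
-- for cs = v ∷ cs′, remove an element u of bs nearest to v, apply induction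
-- to the rest, and use d(y,u) ≤ max{d(y,v), d(u,v)} ≤ d(y,v).
--
-- The theorem then follows by induction on k: given a k+1-tuple bs from C,
-- the exchange lemma against the prefix c₁…c_k yields
--   PER(bs) = PER(bs′) + gain(y, bs′) ≤ PER(c₁…c_k) + gain(y, c₁…c_k)
--           = PER(c₁…c_k, y) ≤ PER(c₁…c_{k+1}),
-- using the induction hypothesis for bs′ and greediness in the last step.

open import Defs
open import Level using (Level)
open import Data.Nat using (ℕ; suc; _<_; _≤_)
open import Data.List using (List; length; take; _∷ʳ_)
open import Data.List.Relation.Unary.All using (All)
open import Relation.Binary.PropositionalEquality using (_≡_)

open import Data.Nat using (zero)
open import Data.Nat.Properties using (suc-injective; <⇒≤; m≤n⇒m⊓n≡m)
open import Data.List using ([]; _∷_)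
open import Data.List.Properties using (length-take)
open import Data.List.Relation.Unary.All using ([]; _∷_) renaming (map to All-map)
open import Data.Product using (∃; ∃₂; _×_; _,_; proj₁; proj₂)
open import Data.Sum using (inj₁; inj₂)
open import Relation.Binary.PropositionalEquality
  using (refl; sym; trans; cong; cong₂; module ≡-Reasoning)
open import Relation.Binary.Bundles using (Preorder)
open import Relation.Binary.Structures using (IsTotalOrder)
open import Algebra.Bundles using (CommutativeSemigroup)
open import Algebra.Structures using (IsAbelianGroup)
import Algebra.Properties.CommutativeSemigroup as CommutativeSemigroupProperties
import Relation.Binary.Reasoning.Preorder as PreorderReasoning

module Lists {a : Level} {A : Set a} where

  -- Insert y b′ b: the list b arises from b′ by inserting y at some position.
  data Insert (y : A) : List A → List A → Set a where
    here  : ∀ {b} → Insert y b (y ∷ b)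
    there : ∀ {x b′ b} → Insert y b′ b → Insert y (x ∷ b′) (x ∷ b)

  insert-length : ∀ {y b′ b} → Insert y b′ b → length b ≡ suc (length b′)
  insert-length here      = refl
  insert-length (there i) = cong suc (insert-length i)

  insert-All : ∀ {p} {P : A → Set p} {y b′ b} →
               Insert y b′ b → All P b → P y × All P b′
  insert-All here      (py ∷ pb) = py , pb
  insert-All (there i) (px ∷ pb) with insert-All i pb
  ... | py , pb′ = py , px ∷ pb′

  insert-snoc : ∀ (xs : List A) (y : A) → Insert y xs (xs ∷ʳ y)
  insert-snoc []       y = here
  insert-snoc (x ∷ xs) y = there (insert-snoc xs y)

  insert-commute : ∀ {u y b₂ b₁ b} → Insert u b₁ b → Insert y b₂ b₁ →
                   ∃ λ b₃ → Insert y b₃ b × Insert u b₂ b₃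
  insert-commute here      j         = _ , there j , here
  insert-commute (there i) here      = _ , here , i
  insert-commute (there i) (there j) with insert-commute i j
  ... | _ , j′ , i′ = _ , there j′ , there i′

  length-prefix : ∀ k (cs : List A) → k ≤ length cs → length (take k cs) ≡ k
  length-prefix k cs k≤|cs| = trans (length-take k cs) (m≤n⇒m⊓n≡m k≤|cs|)

open Lists

module Proof {c ℓ : Level} (R : OrderedAbelianGroup c ℓ) {E : Set}
             (T : FullUltraTriple R E) where
  open OrderedAbelianGroup R renaming (_≤_ to _≼_)
  open FullUltraTriple T
  open Perimeter T
  open IsAbelianGroup isAbelianGroup using (comm; isCommutativeSemigroup)
  open IsTotalOrder isTotalOrder using (total; isPreorder)
    renaming (refl to ≼-refl; trans to ≼-trans)

  commutativeSemigroup : CommutativeSemigroup c c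
  commutativeSemigroup = record { isCommutativeSemigroup = isCommutativeSemigroup }

  open CommutativeSemigroupProperties commutativeSemigroup using (interchange; x∙yz≈y∙xz)

  preorder : Preorder c c ℓ
  preorder = record { isPreorder = isPreorder }

  +-mono-≼ : ∀ {a b x y} → a ≼ b → x ≼ y → a + x ≼ b + y
  +-mono-≼ {a} {b} {x} {y} a≼b x≼y = begin
      a + x  ≲⟨ +-mono-≤ x a≼b ⟩
      b + x  ≡⟨ comm b x ⟩
      x + b  ≲⟨ +-mono-≤ b x≼y ⟩
      y + b  ≡⟨ comm y b ⟩
      b + y  ∎
    where open PreorderReasoning preorder

  gain : E → List E → Carrier
  gain y bs = w y + sumD y bs

  sumW-insert : ∀ {y b′ b} → Insert y b′ b → sumW b ≡ w y + sumW b′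
  sumW-insert here                = refl
  sumW-insert {y} (there {x} i)   =
    trans (cong (w x +_) (sumW-insert i)) (x∙yz≈y∙xz (w x) (w y) _)

  sumD-insert : ∀ z {y b′ b} → Insert y b′ b → sumD z b ≡ d z y + sumD z b′
  sumD-insert z here                = refl
  sumD-insert z {y} (there {x} i)   =
    trans (cong (d z x +_) (sumD-insert z i)) (x∙yz≈y∙xz (d z x) (d z y) _)

  sumPairs-insert : ∀ {y b′ b} → Insert y b′ b → sumPairs b ≡ sumD y b′ + sumPairs b′
  sumPairs-insert here = refl
  sumPairs-insert {y} (there {x} {b′} {b} i) = begin
    sumD x b + sumPairs b
      ≡⟨ cong₂ _+_ (sumD-insert x i) (sumPairs-insert i) ⟩
    (d x y + sumD x b′) + (sumD y b′ + sumPairs b′)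
      ≡⟨ interchange _ _ _ _ ⟩
    (d x y + sumD y b′) + (sumD x b′ + sumPairs b′)
      ≡⟨ cong (λ t → (t + sumD y b′) + (sumD x b′ + sumPairs b′)) (d-sym x y) ⟩
    (d y x + sumD y b′) + (sumD x b′ + sumPairs b′) ∎
    where open ≡-Reasoning

  PER-insert : ∀ {y b′ b} → Insert y b′ b → PER b ≡ PER b′ + gain y b′
  PER-insert {y} {b′} {b} i = begin
    sumW b + sumPairs b                          ≡⟨ cong₂ _+_ (sumW-insert i) (sumPairs-insert i) ⟩
    (w y + sumW b′) + (sumD y b′ + sumPairs b′)  ≡⟨ interchange _ _ _ _ ⟩
    gain y b′ + PER b′                           ≡⟨ comm _ _ ⟩
    PER b′ + gain y b′                           ∎
    where open ≡-Reasoning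

  minimiser : ∀ (f : E → Carrier) x xs →
              ∃₂ λ u rest → Insert u rest (x ∷ xs) × All (λ z → f u ≼ f z) (x ∷ xs)
  minimiser f x [] = x , [] , here , ≼-refl ∷ []
  minimiser f x (x′ ∷ xs) with minimiser f x′ xs
  ... | u , rest , i , u-min with total (f u) (f x)
  ... | inj₁ fu≼fx = u , x ∷ rest , there i , fu≼fx ∷ u-min
  ... | inj₂ fx≼fu = x , x′ ∷ xs , here , ≼-refl ∷ All-map (≼-trans fx≼fu) u-min

  -- Ultrametric inequality: if u is at least as close to v as y is,
  -- then d(y,u) ≤ max{d(y,v), d(u,v)} = d(y,v).
  closer-point : ∀ y u v → d u v ≼ d y v → d y u ≼ d y v
  closer-point y u v duv≼dyv with d-ult y u v
  ... | inj₁ dyu≼dyv = dyu≼dyv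
  ... | inj₂ dyu≼duv = ≼-trans dyu≼duv duv≼dyv

  exchange : ∀ (bs cs : List E) → length bs ≡ suc (length cs) →
             ∃₂ λ y bs′ → Insert y bs′ bs × sumD y bs′ ≼ sumD y cs
  exchange (y ∷ []) [] refl = y , [] , here , ≼-refl
  exchange (x ∷ xs) (v ∷ cs) |bs| with minimiser (λ z → d z v) x xs
  ... | u , rest , u∈bs , u-nearest
        with exchange rest cs (suc-injective (trans (sym (insert-length u∈bs)) |bs|))
  ... | y , rest′ , y∈rest , rest′≼cs with insert-commute u∈bs y∈rest
  ... | bs′ , y∈bs , u∈bs′ = y , bs′ , y∈bs , (begin
      sumD y bs′           ≡⟨ sumD-insert y u∈bs′ ⟩
      d y u + sumD y rest′ ≲⟨ +-mono-≼ (closer-point y u v duv≼dyv) rest′≼cs ⟩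
      d y v + sumD y cs    ∎)
    where
      open PreorderReasoning preorder
      duv≼dyv : d u v ≼ d y v
      duv≼dyv = proj₁ (insert-All y∈rest (proj₂ (insert-All u∈bs u-nearest)))

  greedy-prefix-optimal : (C : E → Set) (m : ℕ) (cs : List E) → length cs ≡ m
    → (∀ i → i < m → ∀ x → C x → PER (take i cs ∷ʳ x) ≼ PER (take (suc i) cs))
    → ∀ k → k ≤ m → ∀ bs → length bs ≡ k → All C bs → PER bs ≼ PER (take k cs)
  greedy-prefix-optimal C m cs refl greedy zero    _   []  _    _  = ≼-refl
  greedy-prefix-optimal C m cs refl greedy (suc k) k<m bs |bs| Cbs
    with exchange bs (take k cs) (trans |bs| (cong suc (sym (length-prefix k cs (<⇒≤ k<m)))))
  ... | y , bs′ , y∈bs , bs′≼prefix with insert-All y∈bs Cbs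
  ... | Cy , Cbs′ = begin
      PER bs                            ≡⟨ PER-insert y∈bs ⟩
      PER bs′ + gain y bs′              ≲⟨ +-mono-≼ bs′-optimal (+-mono-≼ (≼-refl {w y}) bs′≼prefix) ⟩
      PER prefix + gain y prefix        ≡⟨ sym (PER-insert (insert-snoc prefix y)) ⟩
      PER (prefix ∷ʳ y)                 ≲⟨ greedy k k<m y Cy ⟩
      PER (take (suc k) cs)             ∎
    where
      open PreorderReasoning preorder
      prefix = take k cs
      bs′-optimal : PER bs′ ≼ PER prefix
      bs′-optimal = greedy-prefix-optimal C m cs refl greedy k (<⇒≤ k<m) bs′
        (suc-injective (trans (sym (insert-length y∈bs)) |bs|)) Cbs′

theorem8p6 : ∀ {c ℓ : Level} (R : OrderedAbelianGroup c ℓ) (E : Set)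
    (T : FullUltraTriple R E) (C : E → Set) (m : ℕ) (cs : List E)
    → length cs ≡ m → All C cs
    → (∀ (i : ℕ) → i < m → ∀ (x : E) → C x
         → OrderedAbelianGroup._≤_ R (Perimeter.PER T (take i cs ∷ʳ x))
                                     (Perimeter.PER T (take (suc i) cs)))
    → ∀ (k : ℕ) → k ≤ m → ∀ (bs : List E) → length bs ≡ k → All C bs
    → OrderedAbelianGroup._≤_ R (Perimeter.PER T bs) (Perimeter.PER T (take k cs))
theorem8p6 R E T C m cs |cs| _ greedy = Proof.greedy-prefix-optimal R T C m cs |cs| greedy
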